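{- Let $0<\varepsilon<1$. Let $m_1$ and $m_2$ be positive integers with $(2-\varepsilon)m_1<m_2<2m_1$. Suppose that $A\subseteq\mathbb{Z}_{m_1}$ satisfies $\sigma_A(n)\geq 1$ for every $n\in\mathbb{Z}_{m_1}$. Then there is a subset $B\subseteq\mathbb{Z}_{m_2}$ with $|B|\leq 2|A|$ such that $\sigma_B(n)\geq 1$ for every $n\in\mathbb{Z}_{m_2}$.
   Context: $\mathbb{Z}_m$ denotes the set of residue classes modulo $m$. For $A\subseteq\mathbb{Z}_m$ and $n\in\mathbb{Z}_m$, $\sigma_A(n)$ denotes the number of ordered pairs $(x,y)$ with $x,y\in A$ and $n=x+y$ in $\mathbb{Z}_m$.
   Formalization: The parameter ε ranges over the rationals. -}

module Defs where

open import Data.Nat using (ℕ; suc; _+_)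
open import Data.Nat.DivMod using (_mod_)
open import Data.Fin using (Fin; toℕ)
open import Data.Fin.Properties using (_≟_)
open import Data.Fin.Subset using (Subset; _∈_)
open import Data.Fin.Subset.Properties using (_∈?_)
open import Data.List using (List; length; filter; cartesianProduct; allFin)
open import Data.Product using (_×_; _,_)
open import Relation.Binary.PropositionalEquality using (_≡_)
open import Relation.Nullary.Decidable using (_×-dec_)

_+ₘ_ : ∀ {m} → Fin m → Fin m → Fin m
_+ₘ_ {suc k} x y = (toℕ x + toℕ y) mod suc k

σ : ∀ {m} → Subset m → Fin m → ℕ
σ {m} A n = length (filter (λ { (x , y) → (x ∈? A) ×-dec ((y ∈? A) ×-dec ((x +ₘ y) ≟ n)) })
                           (cartesianProduct (allFin m) (allFin m)))

-- Write m₂ = m₁ + d; the hypotheses give d ≤ m₁, and ε < 1 gives m₁ < m₂ (nothing else about ε,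
-- not even ε > 0, is needed). View A ⊆ {0, …, m₁ - 1} inside ℤ_{m₂} and take B = A ∪ (A + d).
-- A residue t < m₁ equals a + b or a + b - m₁ with a, b ∈ A, hence t = a + b or
-- t = (a + d) + b - m₂. For t ≥ m₁ we have t - d < m₁, and t - d = a + b or a + b - m₁ give
-- t = (a + d) + b or t = (a + d) + (b + d) - m₂.
{-# OPTIONS --safe #-}
module Submission where

open import Defs
open import Data.Nat using (ℕ; _<_; _≤_; _*_)
open import Data.Integer using (+_)
open import Data.Rational using (ℚ; 0ℚ; 1ℚ; _/_; _-_) renaming (_<_ to _<ℚ_; _*_ to _*ℚ_)
open import Data.Fin.Subset using (Subset; ∣_∣)
open import Data.Product using (Σ; _×_)

open import Data.Bool using (true; false)
open import Data.Fin as Fin using (Fin; toℕ; fromℕ<; _↑ˡ_; _↑ʳ_)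
import Data.Fin.Properties as Fin
open import Data.Fin.Subset using (_∈_; _∪_; ⊥)
open import Data.Fin.Subset.Properties using (x∈p∪q⁺; ∣⊥∣≡0)
import Data.Integer as ℤ
import Data.Integer.Properties as ℤ
open import Data.List using (List; _∷_; length; filter; cartesianProduct; allFin)
open import Data.List.Membership.Propositional using () renaming (_∈_ to _∈ₗ_)
open import Data.List.Membership.Propositional.Properties
  using (∈-filter⁺; ∈-filter⁻; ∈-cartesianProduct⁺; ∈-allFin; ∈-length)
open import Data.List.Relation.Unary.Any using (here)
open import Data.Nat using (suc; _+_; _%_; NonZero; z≤n; s≤s; _<?_)
import Data.Nat as ℕ
open import Data.Nat.DivMod using (_mod_; m≡m%n+[m/n]*n; m<n*o⇒m/o<n; m<n⇒m%n≡m; [m+n]%n≡m%n)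
open import Data.Nat.Properties
import Data.Nat.Coprimality as Coprime
open import Data.Nat.Tactic.RingSolver using (solve-∀)
open import Data.Product using (∃; ∃₂; _,_)
import Data.Rational as ℚ
import Data.Rational.Properties as ℚ
open import Data.Sum as Sum using (_⊎_; inj₁; inj₂)
open import Data.Vec as Vec using (_++_)
import Data.Vec.Properties as Vec
open import Function using (_∘_)
open import Relation.Binary.PropositionalEquality
open import Relation.Nullary using (yes; no)
open import Relation.Unary using (Pred; Decidable)

ℕ/1-cancel-< : ∀ {m n} → + m / 1 <ℚ + n / 1 → m < n
ℕ/1-cancel-< {m} {n} p =
  ℤ.drop‿+<+ (subst₂ ℤ._<_ (ℤ.*-identityʳ (+ m)) (ℤ.*-identityʳ (+ n))
    (ℚ.drop-*<* (subst₂ _<ℚ_ (ℕ/1≡mkℚ m) (ℕ/1≡mkℚ n) p)))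
  where
  ℕ/1≡mkℚ : ∀ k → + k / 1 ≡ ℚ.mkℚ (+ k) 0 (Coprime.sym (Coprime.1-coprimeTo k))
  ℕ/1≡mkℚ k = ℚ.normalize-coprime _

[2-ε]m<n⇒m<n : ∀ ε → ε <ℚ 1ℚ → ∀ m n → ((+ 2 / 1) - ε) *ℚ (+ m / 1) <ℚ + n / 1 → m < n
[2-ε]m<n⇒m<n ε ε<1 m n [2-ε]m<n = ℕ/1-cancel-< (ℚ.≤-<-trans m≤[2-ε]m [2-ε]m<n)
  where
  1≤2-ε : 1ℚ ℚ.≤ (+ 2 / 1) - ε
  1≤2-ε = ℚ.+-monoʳ-≤ (+ 2 / 1) (ℚ.neg-antimono-≤ (ℚ.<⇒≤ ε<1))
  m≤[2-ε]m : + m / 1 ℚ.≤ ((+ 2 / 1) - ε) *ℚ (+ m / 1)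
  m≤[2-ε]m = subst (ℚ._≤ ((+ 2 / 1) - ε) *ℚ (+ m / 1)) (ℚ.*-identityˡ (+ m / 1))
    (ℚ.*-monoʳ-≤-nonNeg (+ m / 1) {{ℚ.normalize-nonNeg m 1}} 1≤2-ε)

SumOfTwo : ∀ {m} → Subset m → ℕ → Set
SumOfTwo A s = ∃₂ λ x y → x ∈ A × y ∈ A × toℕ x + toℕ y ≡ s

-- A + A = ℤ_m, with the residue t < m read in ℕ as t or t + m.
IsBasis : ∀ {m} → Subset m → Set
IsBasis {m} A = ∀ t → t < m → SumOfTwo A t ⊎ SumOfTwo A (t + m)

m<n+n⇒m≡m%n⊎m≡m%n+n : ∀ {m} n .{{_ : NonZero n}} → m < n + n → m ≡ m % n ⊎ m ≡ m % n + n
m<n+n⇒m≡m%n⊎m≡m%n+n {m} n m<n+n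
  with m ℕ./ n | m<n*o⇒m/o<n {n = 2} (subst (m <_) (cong (_+_ n) (sym (+-identityʳ n))) m<n+n)
     | m≡m%n+[m/n]*n m n
... | 0           | _            | m≡ = inj₁ (trans m≡ (+-identityʳ (m % n)))
... | 1           | _            | m≡ = inj₂ (trans m≡ (cong (_+_ (m % n)) (+-identityʳ n)))
... | suc (suc _) | s≤s (s≤s ()) | _

toℕ-mod : ∀ s k → toℕ (s mod suc k) ≡ s % suc k
toℕ-mod s k = Fin.toℕ-fromℕ< _

toℕ-+ₘ : ∀ {k} (x y : Fin (suc k)) →
         toℕ x + toℕ y ≡ toℕ (x +ₘ y) ⊎ toℕ x + toℕ y ≡ toℕ (x +ₘ y) + suc k
toℕ-+ₘ {k} x y rewrite toℕ-mod (toℕ x + toℕ y) k =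
  m<n+n⇒m≡m%n⊎m≡m%n+n (suc k) (+-mono-< (Fin.toℕ<n x) (Fin.toℕ<n y))

+ₘ-from-toℕ : ∀ {k} (x y n : Fin (suc k)) →
              toℕ x + toℕ y ≡ toℕ n ⊎ toℕ x + toℕ y ≡ toℕ n + suc k → x +ₘ y ≡ n
+ₘ-from-toℕ {k} x y n s≡ = Fin.toℕ-injective (trans (toℕ-mod (toℕ x + toℕ y) k) (%-of s≡))
  where
  %-of : ∀ {s} → s ≡ toℕ n ⊎ s ≡ toℕ n + suc k → s % suc k ≡ toℕ n
  %-of (inj₁ refl) = m<n⇒m%n≡m (Fin.toℕ<n n)
  %-of (inj₂ refl) = trans ([m+n]%n≡m%n (toℕ n) (suc k)) (m<n⇒m%n≡m (Fin.toℕ<n n))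

nonempty⇒∃∈ : ∀ {a} {X : Set a} (xs : List X) → 0 < length xs → ∃ (_∈ₗ xs)
nonempty⇒∃∈ (x ∷ _) _ = x , here refl

filter-nonempty⇒∃ : ∀ {a p} {X : Set a} {P : Pred X p} (P? : Decidable P) xs →
                    0 < length (filter P? xs) → ∃ λ x → x ∈ₗ xs × P x
filter-nonempty⇒∃ P? xs nonempty with nonempty⇒∃∈ (filter P? xs) nonempty
... | x , x∈ = x , ∈-filter⁻ P? x∈

σ≥1⇒pair : ∀ {m} (A : Subset m) n → 1 ≤ σ A n → ∃₂ λ x y → x ∈ A × y ∈ A × x +ₘ y ≡ n
σ≥1⇒pair {m} A n σ≥1 with filter-nonempty⇒∃ _ (cartesianProduct (allFin m) (allFin m)) σ≥1
... | (x , y) , _ , x+y≡n = x , y , x+y≡n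

σ≥1⇒SumOfTwo : ∀ {k} (A : Subset (suc k)) n → 1 ≤ σ A n →
               SumOfTwo A (toℕ n) ⊎ SumOfTwo A (toℕ n + suc k)
σ≥1⇒SumOfTwo A n σ≥1 with σ≥1⇒pair A n σ≥1
... | x , y , x∈A , y∈A , refl =
  Sum.map (λ s≡ → x , y , x∈A , y∈A , s≡) (λ s≡ → x , y , x∈A , y∈A , s≡) (toℕ-+ₘ x y)

pair⇒σ≥1 : ∀ {m} (A : Subset m) {n} {x y : Fin m} → x ∈ A → y ∈ A → x +ₘ y ≡ n → 1 ≤ σ A n
pair⇒σ≥1 A {x = x} {y} x∈A y∈A x+y≡n =
  ∈-length (∈-filter⁺ _ (∈-cartesianProduct⁺ (∈-allFin x) (∈-allFin y)) (x∈A , y∈A , x+y≡n))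

SumOfTwo⇒σ≥1 : ∀ {k} (A : Subset (suc k)) n →
               SumOfTwo A (toℕ n) ⊎ SumOfTwo A (toℕ n + suc k) → 1 ≤ σ A n
SumOfTwo⇒σ≥1 A n (inj₁ (x , y , x∈A , y∈A , s≡)) = pair⇒σ≥1 A x∈A y∈A (+ₘ-from-toℕ x y n (inj₁ s≡))
SumOfTwo⇒σ≥1 A n (inj₂ (x , y , x∈A , y∈A , s≡)) = pair⇒σ≥1 A x∈A y∈A (+ₘ-from-toℕ x y n (inj₂ s≡))

σ≥1⇒IsBasis : ∀ {k} {A : Subset (suc k)} → (∀ n → 1 ≤ σ A n) → IsBasis A
σ≥1⇒IsBasis {k} {A} σ≥1 t t<m =
  subst (λ u → SumOfTwo A u ⊎ SumOfTwo A (u + suc k)) (Fin.toℕ-fromℕ< t<m)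
    (σ≥1⇒SumOfTwo A _ (σ≥1 (fromℕ< t<m)))

IsBasis⇒σ≥1 : ∀ {k} {A : Subset (suc k)} → IsBasis A → ∀ n → 1 ≤ σ A n
IsBasis⇒σ≥1 {A = A} basis n = SumOfTwo⇒σ≥1 A n (basis (toℕ n) (Fin.toℕ<n n))

∣p∪q∣≤∣p∣+∣q∣ : ∀ {n} (p q : Subset n) → ∣ p ∪ q ∣ ≤ ∣ p ∣ + ∣ q ∣
∣p∪q∣≤∣p∣+∣q∣ Vec.[]          Vec.[]          = z≤n
∣p∪q∣≤∣p∣+∣q∣ (true Vec.∷ p)  (true Vec.∷ q)  =
  s≤s (≤-trans (∣p∪q∣≤∣p∣+∣q∣ p q) (+-monoʳ-≤ ∣ p ∣ (n≤1+n ∣ q ∣)))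
∣p∪q∣≤∣p∣+∣q∣ (true Vec.∷ p)  (false Vec.∷ q) = s≤s (∣p∪q∣≤∣p∣+∣q∣ p q)
∣p∪q∣≤∣p∣+∣q∣ (false Vec.∷ p) (true Vec.∷ q)  =
  subst (suc ∣ p ∪ q ∣ ≤_) (sym (+-suc ∣ p ∣ ∣ q ∣)) (s≤s (∣p∪q∣≤∣p∣+∣q∣ p q))
∣p∪q∣≤∣p∣+∣q∣ (false Vec.∷ p) (false Vec.∷ q) = ∣p∪q∣≤∣p∣+∣q∣ p q

∣p++q∣≡∣p∣+∣q∣ : ∀ {m n} (p : Subset m) (q : Subset n) → ∣ p ++ q ∣ ≡ ∣ p ∣ + ∣ q ∣
∣p++q∣≡∣p∣+∣q∣ Vec.[]          q = refl
∣p++q∣≡∣p∣+∣q∣ (true Vec.∷ p)  q = cong suc (∣p++q∣≡∣p∣+∣q∣ p q)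
∣p++q∣≡∣p∣+∣q∣ (false Vec.∷ p) q = ∣p++q∣≡∣p∣+∣q∣ p q

∣cast∣≡∣∣ : ∀ {m n} (eq : m ≡ n) (p : Subset m) → ∣ Vec.cast eq p ∣ ≡ ∣ p ∣
∣cast∣≡∣∣ refl p = cong ∣_∣ (Vec.cast-is-id refl p)

m+[n+o]≡n+[o+m] : ∀ m n o → m + (n + o) ≡ n + (o + m)
m+[n+o]≡n+[o+m] = solve-∀

[m+n]+[m+o]≡m+[m+[n+o]] : ∀ m n o → (m + n) + (m + o) ≡ m + (m + (n + o))
[m+n]+[m+o]≡m+[m+[n+o]] = solve-∀

m+[m+[n+o]]≡[m+n]+[o+m] : ∀ m n o → m + (m + (n + o)) ≡ (m + n) + (o + m)
m+[m+[n+o]]≡[m+n]+[o+m] = solve-∀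

module Doubling {m : ℕ} (d : ℕ) (A : Subset m) where

  d+m≡m+d : d + m ≡ m + d
  d+m≡m+d = +-comm d m

  A↑ A+d B : Subset (m + d)
  A↑  = A ++ ⊥
  A+d = Vec.cast d+m≡m+d (⊥ {d} ++ A)
  B   = A↑ ∪ A+d

  ∣A↑∣≡∣A∣ : ∣ A↑ ∣ ≡ ∣ A ∣
  ∣A↑∣≡∣A∣ = trans (∣p++q∣≡∣p∣+∣q∣ A ⊥) (trans (cong (_+_ ∣ A ∣) (∣⊥∣≡0 d)) (+-identityʳ ∣ A ∣))

  ∣A+d∣≡∣A∣ : ∣ A+d ∣ ≡ ∣ A ∣
  ∣A+d∣≡∣A∣ = trans (∣cast∣≡∣∣ d+m≡m+d (⊥ ++ A))
                (trans (∣p++q∣≡∣p∣+∣q∣ (⊥ {d}) A) (cong (_+ ∣ A ∣) (∣⊥∣≡0 d)))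

  ∣B∣≤2∣A∣ : ∣ B ∣ ≤ 2 * ∣ A ∣
  ∣B∣≤2∣A∣ = begin
    ∣ B ∣              ≤⟨ ∣p∪q∣≤∣p∣+∣q∣ A↑ A+d ⟩
    ∣ A↑ ∣ + ∣ A+d ∣   ≡⟨ cong₂ _+_ ∣A↑∣≡∣A∣ ∣A+d∣≡∣A∣ ⟩
    ∣ A ∣ + ∣ A ∣      ≡⟨ cong (_+_ ∣ A ∣) (sym (+-identityʳ ∣ A ∣)) ⟩
    2 * ∣ A ∣          ∎
    where open ≤-Reasoning

  shift : Fin m → Fin (m + d)
  shift x = Fin.cast d+m≡m+d (d ↑ʳ x)

  toℕ-shift : ∀ x → toℕ (shift x) ≡ d + toℕ x
  toℕ-shift x = trans (Fin.toℕ-cast d+m≡m+d (d ↑ʳ x)) (Fin.toℕ-↑ʳ d x)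

  ↑ˡ-∈B : ∀ {x} → x ∈ A → x ↑ˡ d ∈ B
  ↑ˡ-∈B {x} x∈A = x∈p∪q⁺ (inj₁ (Vec.lookup⇒[]= _ _ (begin
    Vec.lookup A↑ (x ↑ˡ d)  ≡⟨ Vec.lookup-++ˡ A ⊥ x ⟩
    Vec.lookup A x          ≡⟨ Vec.[]=⇒lookup x∈A ⟩
    true                    ∎)))
    where open ≡-Reasoning

  shift-∈B : ∀ {x} → x ∈ A → shift x ∈ B
  shift-∈B {x} x∈A = x∈p∪q⁺ {p = A↑} (inj₂ (Vec.lookup⇒[]= _ _ (begin
    Vec.lookup A+d (shift x)          ≡⟨ Vec.lookup-cast d+m≡m+d (⊥ ++ A) (d ↑ʳ x) ⟩
    Vec.lookup (⊥ {d} ++ A) (d ↑ʳ x)  ≡⟨ Vec.lookup-++ʳ (⊥ {d}) A x ⟩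
    Vec.lookup A x                    ≡⟨ Vec.[]=⇒lookup x∈A ⟩
    true                              ∎)))
    where open ≡-Reasoning

  SumOfTwo-↑ˡ : ∀ {s} → SumOfTwo A s → SumOfTwo B s
  SumOfTwo-↑ˡ (x , y , x∈A , y∈A , refl) =
    x ↑ˡ d , y ↑ˡ d , ↑ˡ-∈B x∈A , ↑ˡ-∈B y∈A , cong₂ _+_ (Fin.toℕ-↑ˡ x d) (Fin.toℕ-↑ˡ y d)

  SumOfTwo-shift : ∀ {s} → SumOfTwo A s → SumOfTwo B (d + s)
  SumOfTwo-shift (x , y , x∈A , y∈A , refl) =
    shift x , y ↑ˡ d , shift-∈B x∈A , ↑ˡ-∈B y∈A ,
    trans (cong₂ _+_ (toℕ-shift x) (Fin.toℕ-↑ˡ y d)) (+-assoc d (toℕ x) (toℕ y))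

  SumOfTwo-shift₂ : ∀ {s} → SumOfTwo A s → SumOfTwo B (d + (d + s))
  SumOfTwo-shift₂ (x , y , x∈A , y∈A , refl) =
    shift x , shift y , shift-∈B x∈A , shift-∈B y∈A ,
    trans (cong₂ _+_ (toℕ-shift x) (toℕ-shift y)) ([m+n]+[m+o]≡m+[m+[n+o]] d (toℕ x) (toℕ y))

  B-isBasis : d ≤ m → IsBasis A → IsBasis B
  B-isBasis d≤m basis t t<m+d with t <? m
  ... | yes t<m =
    Sum.map SumOfTwo-↑ˡ (subst (SumOfTwo B) (m+[n+o]≡n+[o+m] d t m) ∘ SumOfTwo-shift) (basis t t<m)
  ... | no t≮m with m≤n⇒∃[o]m+o≡n (≤-trans d≤m (≮⇒≥ t≮m))
  ...   | u , refl =
    Sum.map SumOfTwo-shift (subst (SumOfTwo B) (m+[m+[n+o]]≡[m+n]+[o+m] d u m) ∘ SumOfTwo-shift₂)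
      (basis u (+-cancelˡ-< d u m (subst (d + u <_) (+-comm m d) t<m+d)))

lemma5 : (ε : ℚ) → 0ℚ <ℚ ε → ε <ℚ 1ℚ →
    (m₁ m₂ : ℕ) → 0 < m₁ → 0 < m₂ →
    ((+ 2 / 1) - ε) *ℚ (+ m₁ / 1) <ℚ (+ m₂ / 1) → m₂ < 2 * m₁ →
    (A : Subset m₁) → (∀ n → 1 ≤ σ A n) →
    Σ (Subset m₂) (λ B → ∣ B ∣ ≤ 2 * ∣ A ∣ × (∀ n → 1 ≤ σ B n))
lemma5 ε _ ε<1 m₁@(suc _) m₂ _ _ [2-ε]m₁<m₂ m₂<2m₁ A σA≥1
  with m≤n⇒∃[o]m+o≡n (<⇒≤ ([2-ε]m<n⇒m<n ε ε<1 m₁ m₂ [2-ε]m₁<m₂))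
... | d , refl = B , ∣B∣≤2∣A∣ , IsBasis⇒σ≥1 (B-isBasis d≤m₁ (σ≥1⇒IsBasis σA≥1))
  where
  open Doubling d A
  d≤m₁ : d ≤ m₁
  d≤m₁ = <⇒≤ (+-cancelˡ-< m₁ d m₁ (subst (m₁ + d <_) (cong (_+_ m₁) (+-identityʳ m₁)) m₂<2m₁))
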